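{- Every macro-step system $(S,\{\to_e,\to_{\neg e}\})$ satisfies $\to_e$-factorization: if $t\to^* s$ (where $\to\;=\;\to_e\cup\to_{\neg e}$), then there exists $u$ such that $t\to_e^* u\to_{\neg e}^* s$.
   Context: A rewriting system $(S,\{\to_e,\to_{\neg e}\})$ is the pair $(S,\to)$ with $S$ a set and $\to\;=\;\to_e\cup\to_{\neg e}$ for binary relations $\to_e,\to_{\neg e}$ on $S$. $\to^*$ denotes reflexive-transitive closure, and $t\to_a\cdot\to_b s$ means $t\to_a u\to_b s$ for some $u$. It is a macro-step system if there exist binary relations $\Rightarrow$ and $\Rightarrow_{\neg e}$ on $S$ such that: (Macro) $\to_{\neg e}\subseteq\Rightarrow_{\neg e}\subseteq\to_{\neg e}^*$; (Merge) if $t\Rightarrow_{\neg e}\cdot\to_e u$ then $t\Rightarrow u$; (Split) if $t\Rightarrow u$ then $t\to_e^*\cdot\Rightarrow_{\neg e}u$. -}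

module Defs where

open import Level using (Level; _⊔_; suc)
open import Relation.Binary.Core using (Rel)
open import Relation.Binary.Construct.Closure.ReflexiveTransitive using (Star)
open import Relation.Binary.Construct.Union using (_∪_)
open import Data.Product using (∃; _×_; _,_)

_⨾_ : ∀ {a ℓ₁ ℓ₂} {S : Set a} → Rel S ℓ₁ → Rel S ℓ₂ → Rel S (a ⊔ ℓ₁ ⊔ ℓ₂)
(R ⨾ Q) t s = ∃ λ u → R t u × Q u s

_⊆_ : ∀ {a ℓ₁ ℓ₂} {S : Set a} → Rel S ℓ₁ → Rel S ℓ₂ → Set (a ⊔ ℓ₁ ⊔ ℓ₂)
R ⊆ Q = ∀ {t s} → R t s → Q t s

record IsMacroStep {a ℓ} {S : Set a} (→e →ne : Rel S ℓ) (ℓ' : Level)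
       : Set (a ⊔ ℓ ⊔ suc ℓ') where
  field
    _⇒_   : Rel S ℓ'
    _⇒ne_ : Rel S ℓ'
    macro₁ : →ne ⊆ _⇒ne_
    macro₂ : _⇒ne_ ⊆ Star →ne
    merge  : (_⇒ne_ ⨾ →e) ⊆ _⇒_
    split  : _⇒_ ⊆ (Star →e ⨾ _⇒ne_)

MacroStepSystem : ∀ {a ℓ} {S : Set a} (→e →ne : Rel S ℓ) (ℓ' : Level) → Set (a ⊔ ℓ ⊔ suc ℓ')
MacroStepSystem →e →ne ℓ' = IsMacroStep →e →ne ℓ'

Factorization : ∀ {a ℓ} {S : Set a} (→e →ne : Rel S ℓ) → Set (a ⊔ ℓ)
Factorization →e →ne = Star (→e ∪ →ne) ⊆ (Star →e ⨾ Star →ne)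

-- Merge followed by Split pushes a non-essential macro-step ⇒¬e past one
-- essential step, hence past any sequence of them. Factorizing a reduction from
-- right to left, each →¬e step is a macro-step (Macro) that is postponed behind
-- the →e* prefix of the already factorized tail, and then unfolded into →¬e*.
module Submission where

open import Defs
open import Level using (Level)
open import Relation.Binary.Core using (Rel)
open import Relation.Binary.Construct.Closure.ReflexiveTransitive using (Star; ε; _◅_; _◅◅_)
open import Data.Sum using (inj₁; inj₂)
open import Data.Product using (_,_)

module _ {a ℓ₁ ℓ₂} {S : Set a} {R : Rel S ℓ₁} {E : Rel S ℓ₂} where

  postpone-Star : (R ⨾ E) ⊆ (Star E ⨾ R) → (R ⨾ Star E) ⊆ (Star E ⨾ R)
  postpone-Star swap (_ , r , es) = go r es
    where
    go : ∀ {t u v} → R t u → Star E u v → (Star E ⨾ R) t v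
    go r ε = _ , ε , r
    go r (e ◅ es) with swap (_ , r , e)
    ... | _ , es₁ , r₁ with go r₁ es
    ... | _ , es₂ , r₂ = _ , es₁ ◅◅ es₂ , r₂

module _ {a ℓ ℓ'} {S : Set a} {→e →ne : Rel S ℓ} (M : IsMacroStep →e →ne ℓ') where
  open IsMacroStep M

  ⇒ne-postpone-→e : (_⇒ne_ ⨾ →e) ⊆ (Star →e ⨾ _⇒ne_)
  ⇒ne-postpone-→e p = split (merge p)

  factorize : Factorization →e →ne
  factorize ε = _ , ε , ε
  factorize (inj₁ e ◅ steps) with factorize steps
  ... | _ , es , ns = _ , e ◅ es , ns
  factorize (inj₂ n ◅ steps) with factorize steps
  ... | _ , es , ns with postpone-Star ⇒ne-postpone-→e (_ , macro₁ n , es)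
  ... | _ , es′ , m = _ , es′ , macro₂ m ◅◅ ns

proposition1 : ∀ {a ℓ ℓ'} {S : Set a} (→e →ne : Rel S ℓ) →
    MacroStepSystem →e →ne ℓ' → Factorization →e →ne
proposition1 →e →ne = factorize
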